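{- Let $x:[t]\to\mathbb{Z}\setminus\{0\}$ be such that $(x(1),\ldots,x(t))$ is generalized Catalan, and let $\pi\in\mathfrak{S}_t$ be the permutation associated to $x$. Then the list $(x(\pi(1)),x(\pi(2)),\ldots,x(\pi(t)))$ is generalized Catalan.
   Context: A list $(x_1,\ldots,x_t)$ of nonzero integers is generalized Catalan if $\sum_{i=1}^t x_i=0$ and $\sum_{i=1}^q x_i\ge0$ for all $1\le q\le t$. $[t]=\{1,\ldots,t\}$. The permutation $\pi$ associated to $x$: $\pi(1)=1$; for $2\le q\le t$, let $s=\min\{i\in[t]: i\notin\{\pi(1),\ldots,\pi(q-1)\},\ x(i)<0\}$ and $s'=\min\{i\in[t]: i\notin\{\pi(1),\ldots,\pi(q-1)\},\ x(i)>0\}$ (minimum of the empty set is $\infty$); then $\pi(q)=s$ if $s<\infty$ and $\sum_{i=1}^{q-1}x(\pi(i))+x(s)\ge0$, and $\pi(q)=s'$ otherwise. (This construction always yields a permutation of $[t]$.) -}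

module Defs where

open import Data.Nat using (ℕ; zero; suc)
import Data.Nat as ℕ
open import Data.Integer using (ℤ; _+_; _≤_; _<_; _<?_; _≤?_; 0ℤ)
open import Data.Fin using (Fin) renaming (zero to fzero)
open import Data.Fin.Properties using () renaming (_≟_ to _≟ᶠ_)
open import Data.List using (List; []; _∷_; foldr; take; length; map; filter; _++_; [_])
open import Data.List.Base using (head)
import Data.List.Relation.Unary.Any
open import Data.List.Relation.Unary.Any using (any?)
open import Relation.Binary.PropositionalEquality using (_≡_)
open import Relation.Nullary using (Dec)
open import Data.List.Relation.Unary.All using (All)
open import Data.Maybe using (Maybe; just; nothing)
open import Data.Product using (_×_)
open import Relation.Binary.PropositionalEquality using (_≢_)
open import Relation.Nullary using (¬?; yes; no)
open import Data.Vec.Functional using () renaming (Vector to FVec)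
open import Data.List using (allFin)

sumℤ : List ℤ → ℤ
sumℤ = foldr _+_ 0ℤ

IsGenCatalan : List ℤ → Set
IsGenCatalan xs =
  All (λ a → a ≢ 0ℤ) xs
  × sumℤ xs ≡ 0ℤ
  × (∀ q → 1 ℕ.≤ q → q ℕ.≤ length xs → 0ℤ ≤ sumℤ (take q xs))
  where open import Relation.Binary.PropositionalEquality using (_≡_)

toList : ∀ {t} → (Fin t → ℤ) → List ℤ
toList {t} x = map x (allFin t)

_∈?_ : ∀ {t} (i : Fin t) (xs : List (Fin t)) → Dec (Data.List.Relation.Unary.Any.Any (i ≡_) xs)
i ∈? xs = any? (i ≟ᶠ_) xs

-- least index in [t] (in the natural order) not in `used` whose value
-- satisfies the (decidable) sign condition; nothing = ∞
firstUnusedNeg firstUnusedPos : ∀ {t} → (Fin t → ℤ) → List (Fin t) → Maybe (Fin t)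
firstUnusedNeg {t} x used =
  head (filter (λ i → x i <? 0ℤ) (filter (λ i → ¬? (i ∈? used)) (allFin t)))
firstUnusedPos {t} x used =
  head (filter (λ i → 0ℤ <? x i) (filter (λ i → ¬? (i ∈? used)) (allFin t)))

-- one step of the construction: given π(1..q-1) (as `used`) and the
-- partial sum S = Σ_{i<q} x(π(i)), choose π(q).
-- If s' = ∞ and the negative choice is not allowed, the paper's rule would
-- give ∞ (which never happens for generalized Catalan x); we then fall back
-- to s (and stop if both are ∞).
nextIndex : ∀ {t} → (Fin t → ℤ) → List (Fin t) → ℤ → Maybe (Fin t)
nextIndex x used S with firstUnusedNeg x used | firstUnusedPos x used
... | just s  | s' with 0ℤ ≤? (S + x s)
...   | yes _ = just s
...   | no _ with s'
...     | just j = just j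
...     | nothing = just s
nextIndex x used S | nothing | s' = s'

runSteps : ∀ {t} → (Fin t → ℤ) → ℕ → List (Fin t) → ℤ → List (Fin t)
runSteps x zero used S = used
runSteps x (suc k) used S with nextIndex x used S
... | just j  = runSteps x k (used ++ [ j ]) (S + x j)
... | nothing = used

assocPerm : ∀ {t} → (Fin t → ℤ) → List (Fin t)
assocPerm {zero} x = []
assocPerm {suc t} x = runSteps x t (fzero ∷ []) (x fzero)

{-# OPTIONS --safe #-}
-- The construction keeps every prefix sum nonnegative: a negative entry is only
-- taken when the running sum can afford it, and a positive entry never hurts.
-- The exceptional case is a negative entry taken because no positive entry is
-- left: then all unused entries are negative and, the total being 0, the
-- running sum equals minus their sum, which is at least minus any one of them.
-- Every step consumes a fresh index, so after t steps all indices are used and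
-- the rearranged list has total sum 0 as well.
module Submission where

open import Defs
open import Data.Nat using (ℕ)
open import Data.Integer using (ℤ; 0ℤ)
open import Data.Fin using (Fin)
open import Data.List using (map)
open import Relation.Binary.PropositionalEquality using (_≢_)

import Data.Nat as ℕ
import Data.Nat.Properties as ℕ
open import Data.Integer using (_+_; _≤_; _<?_; _≤?_)
import Data.Integer.Properties as ℤ
open import Data.Fin using () renaming (zero to fzero)
open import Data.Fin.Properties using () renaming (_≟_ to _≟ᶠ_)
open import Data.List using (List; []; _∷_; _++_; [_]; _∷ʳ_; take; length; filter; head; allFin)
open import Data.List.Properties
  using (filter-accept; filter-reject; filter-all; ++-assoc; map-++; length-++; length-tabulate; take-all)
open import Data.List.Membership.Propositional using (_∈_; _∉_)
open import Data.List.Membership.Propositional.Properties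
  using (∈-filter⁺; ∈-filter⁻; ∈-allFin; ∈-++⁺ˡ; ∈-++⁺ʳ; ∈-++⁻; ∈-map⁺)
open import Data.List.Relation.Unary.Any using (here; there; any?)
open import Data.List.Relation.Unary.All as All using (All; []; _∷_)
import Data.List.Relation.Unary.All.Properties as All
open import Data.List.Relation.Unary.AllPairs using ([]; _∷_)
open import Data.List.Relation.Unary.Unique.Propositional using (Unique)
open import Data.List.Relation.Unary.Unique.Propositional.Properties using (allFin⁺)
open import Data.List.Relation.Binary.Permutation.Propositional
  using (_↭_; refl; prep; swap; trans; ↭-sym; ↭-reflexive; ↭⇒↭ₛ; module PermutationReasoning)
open import Data.List.Relation.Binary.Permutation.Propositional.Properties using (↭-length; ++⁺ˡ; map⁺)
open import Data.List.Relation.Binary.Permutation.Setoid.Properties using (foldr-commMonoid)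
open import Data.Maybe using (Maybe; just; nothing)
open import Data.Product using (_×_; _,_; proj₁)
open import Data.Sum using (_⊎_; inj₁; inj₂)
open import Relation.Nullary using (¬_; Dec; yes; no; ¬?; contradiction)
open import Level using (0ℓ)
open import Relation.Unary using (Pred; Decidable)
open import Relation.Binary using (DecidableEquality)
open import Relation.Binary.PropositionalEquality as ≡ using (_≡_; cong; sym; subst)

sumℤ-++ : ∀ (xs ys : List ℤ) → sumℤ (xs ++ ys) ≡ sumℤ xs + sumℤ ys
sumℤ-++ [] ys = sym (ℤ.+-identityˡ _)
sumℤ-++ (a ∷ xs) ys = ≡.trans (cong (a +_) (sumℤ-++ xs ys)) (sym (ℤ.+-assoc a _ _))

sumℤ-∷ʳ : ∀ (xs : List ℤ) a → sumℤ (xs ∷ʳ a) ≡ sumℤ xs + a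
sumℤ-∷ʳ xs a = ≡.trans (sumℤ-++ xs [ a ]) (cong (sumℤ xs +_) (ℤ.+-identityʳ a))

sumℤ-↭ : ∀ {xs ys : List ℤ} → xs ↭ ys → sumℤ xs ≡ sumℤ ys
sumℤ-↭ p = foldr-commMonoid (≡.setoid ℤ) ℤ.+-0-isCommutativeMonoid (↭⇒↭ₛ p)

sumℤ-nonpos : ∀ {xs : List ℤ} → All (_≤ 0ℤ) xs → sumℤ xs ≤ 0ℤ
sumℤ-nonpos [] = ℤ.≤-refl
sumℤ-nonpos (a≤0 ∷ xs≤0) = ℤ.+-mono-≤ a≤0 (sumℤ-nonpos xs≤0)

sumℤ-nonpos≤∈ : ∀ {a} {xs : List ℤ} → All (_≤ 0ℤ) xs → a ∈ xs → sumℤ xs ≤ a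
sumℤ-nonpos≤∈ {a} (_ ∷ xs≤0) (here ≡.refl) =
  subst (a + _ ≤_) (ℤ.+-identityʳ a) (ℤ.+-monoʳ-≤ a (sumℤ-nonpos xs≤0))
sumℤ-nonpos≤∈ {a} (b≤0 ∷ xs≤0) (there a∈xs) =
  subst (_ ≤_) (ℤ.+-identityˡ a) (ℤ.+-mono-≤ b≤0 (sumℤ-nonpos≤∈ xs≤0 a∈xs))

PrefixSumsNonneg : List ℤ → Set
PrefixSumsNonneg xs = ∀ q → 1 ℕ.≤ q → q ℕ.≤ length xs → 0ℤ ≤ sumℤ (take q xs)

take-++ˡ : ∀ {A : Set} q (xs ys : List A) → q ℕ.≤ length xs → take q (xs ++ ys) ≡ take q xs
take-++ˡ ℕ.zero xs ys _ = ≡.refl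
take-++ˡ (ℕ.suc q) (a ∷ xs) ys (ℕ.s≤s q≤) = cong (a ∷_) (take-++ˡ q xs ys q≤)

prefixSumsNonneg-∷ʳ : ∀ {xs} a → PrefixSumsNonneg xs → 0ℤ ≤ sumℤ xs + a → PrefixSumsNonneg (xs ∷ʳ a)
prefixSumsNonneg-∷ʳ {xs} a prefixes total q 1≤q q≤ with q ℕ.≤? length xs
... | yes q≤xs = subst (λ ys → 0ℤ ≤ sumℤ ys) (sym (take-++ˡ q xs [ a ] q≤xs)) (prefixes q 1≤q q≤xs)
... | no q≰xs = subst (λ ys → 0ℤ ≤ sumℤ ys) (sym (take-all q (xs ∷ʳ a) length≤q))
                  (subst (0ℤ ≤_) (sym (sumℤ-∷ʳ xs a)) total)
  where
  length≤q : length (xs ∷ʳ a) ℕ.≤ q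
  length≤q = subst (ℕ._≤ q) (≡.trans (ℕ.+-comm 1 (length xs)) (sym (length-++ xs))) (ℕ.≰⇒> q≰xs)

module _ {A : Set} {P : Pred A 0ℓ} (P? : Decidable P) where

  head-filter-just : ∀ {a} xs → head (filter P? xs) ≡ just a → a ∈ xs × P a
  head-filter-just xs eq = ∈-filter⁻ P? (head-∈ (filter P? xs) eq)
    where
    head-∈ : ∀ {a} ys → head ys ≡ just a → a ∈ ys
    head-∈ (b ∷ ys) ≡.refl = here ≡.refl

  head-filter-nothing : ∀ {a} xs → head (filter P? xs) ≡ nothing → a ∈ xs → ¬ P a
  head-filter-nothing xs eq a∈xs Pa with filter P? xs | ∈-filter⁺ P? a∈xs Pa
  head-filter-nothing xs () a∈xs Pa | _ ∷ _ | _

no-member⇒[] : ∀ {A : Set} (xs : List A) → (∀ {a} → a ∉ xs) → xs ≡ []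
no-member⇒[] []      _    = ≡.refl
no-member⇒[] (a ∷ _) a∉xs = contradiction (here ≡.refl) a∉xs

module Unused {A : Set} (_≟_ : DecidableEquality A) where

  _∉?_ : (a : A) (U : List A) → Dec (a ∉ U)
  a ∉? U = ¬? (any? (a ≟_) U)

  ∈⊎∉ : ∀ a U → a ∈ U ⊎ a ∉ U
  ∈⊎∉ a U with any? (a ≟_) U
  ... | yes a∈U = inj₁ a∈U
  ... | no a∉U = inj₂ a∉U

  unusedIn : List A → List A → List A
  unusedIn U = filter (_∉? U)

  ∉-∷ʳ : ∀ {a j : A} U → a ∉ U → a ≢ j → a ∉ U ∷ʳ j
  ∉-∷ʳ U a∉U a≢j a∈ with ∈-++⁻ U a∈
  ... | inj₁ a∈U = a∉U a∈U
  ... | inj₂ (here a≡j) = a≢j a≡j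

  unusedIn-∷ʳ-fresh : ∀ U {j : A} L → All (j ≢_) L → unusedIn U L ≡ unusedIn (U ∷ʳ j) L
  unusedIn-∷ʳ-fresh U [] [] = ≡.refl
  unusedIn-∷ʳ-fresh U {j} (b ∷ L) (j≢b ∷ fresh) with ∈⊎∉ b U
  ... | inj₁ b∈U rewrite filter-reject (_∉? U) {b} {L} (λ b∉U → b∉U b∈U)
                      | filter-reject (_∉? (U ∷ʳ j)) {b} {L} (λ b∉ → b∉ (∈-++⁺ˡ b∈U))
                      = unusedIn-∷ʳ-fresh U L fresh
  ... | inj₂ b∉U rewrite filter-accept (_∉? U) {b} {L} b∉U
                     | filter-accept (_∉? (U ∷ʳ j)) {b} {L} (∉-∷ʳ U b∉U (λ b≡j → j≢b (sym b≡j)))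
                     = cong (b ∷_) (unusedIn-∷ʳ-fresh U L fresh)

  unusedIn-∷ʳ-↭ : ∀ U {j : A} L → Unique L → j ∈ unusedIn U L → unusedIn U L ↭ j ∷ unusedIn (U ∷ʳ j) L
  unusedIn-∷ʳ-↭ U {j} (b ∷ L) (b∉L ∷ unique) j∈ with ∈⊎∉ b U
  ... | inj₁ b∈U rewrite filter-reject (_∉? U) {b} {L} (λ b∉U → b∉U b∈U)
                      | filter-reject (_∉? (U ∷ʳ j)) {b} {L} (λ b∉ → b∉ (∈-++⁺ˡ b∈U))
                      = unusedIn-∷ʳ-↭ U L unique j∈
  ... | inj₂ b∉U with b ≟ j
  ...   | yes ≡.refl rewrite filter-accept (_∉? U) {b} {L} b∉U
                           | filter-reject (_∉? (U ∷ʳ b)) {b} {L} (λ b∉ → b∉ (∈-++⁺ʳ U (here ≡.refl)))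
                           = prep b (↭-reflexive (unusedIn-∷ʳ-fresh U L b∉L))
  ...   | no b≢j rewrite filter-accept (_∉? U) {b} {L} b∉U
                       | filter-accept (_∉? (U ∷ʳ j)) {b} {L} (∉-∷ʳ U b∉U b≢j)
                       with j∈
  ...     | here j≡b = contradiction (sym j≡b) b≢j
  ...     | there j∈′ = trans (prep b (unusedIn-∷ʳ-↭ U L unique j∈′)) (swap b j refl)

  ++-unusedIn-∷ʳ-↭ : ∀ U {j : A} L → Unique L → j ∈ unusedIn U L →
    U ++ unusedIn U L ↭ L → U ∷ʳ j ++ unusedIn (U ∷ʳ j) L ↭ L
  ++-unusedIn-∷ʳ-↭ U {j} L unique j∈ U↭ = begin
    U ∷ʳ j ++ unusedIn (U ∷ʳ j) L  ≡⟨ ++-assoc U [ j ] _ ⟩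
    U ++ j ∷ unusedIn (U ∷ʳ j) L   ↭⟨ ++⁺ˡ U (↭-sym (unusedIn-∷ʳ-↭ U L unique j∈)) ⟩
    U ++ unusedIn U L              ↭⟨ U↭ ⟩
    L                              ∎
    where open PermutationReasoning

module Construction {t : ℕ} (x : Fin t → ℤ) where

  open Unused (_≟ᶠ_ {t})

  unused : List (Fin t) → List (Fin t)
  unused U = unusedIn U (allFin t)

  ∈-unused : ∀ {U i} → i ∉ U → i ∈ unused U
  ∈-unused {U} {i} i∉U = ∈-filter⁺ (_∉? U) (∈-allFin i) i∉U

  Σx : List (Fin t) → ℤ
  Σx U = sumℤ (map x U)

  Σx-∷ʳ : ∀ U j → Σx (U ∷ʳ j) ≡ Σx U + x j
  Σx-∷ʳ U j = ≡.trans (cong sumℤ (map-++ x U [ j ])) (sumℤ-∷ʳ (map x U) (x j))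

  record Admissible (U : List (Fin t)) : Set where
    field
      covers     : U ++ unused U ↭ allFin t
      prefixSums : PrefixSumsNonneg (map x U)
      sum-nonneg : 0ℤ ≤ Σx U

  admissible-[] : Admissible []
  admissible-[] = record
    { covers     = ↭-reflexive (filter-all (_∉? []) (All.universal (λ _ ()) (allFin t)))
    ; prefixSums = λ { q (ℕ.s≤s _) () }
    ; sum-nonneg = ℤ.≤-refl
    }

  admissible-∷ʳ : ∀ {U j} → Admissible U → j ∈ unused U → 0ℤ ≤ Σx U + x j → Admissible (U ∷ʳ j)
  admissible-∷ʳ {U} {j} adm j∈ nonneg = record
    { covers     = ++-unusedIn-∷ʳ-↭ U (allFin t) (allFin⁺ t) j∈ covers
    ; prefixSums = subst PrefixSumsNonneg (sym (map-++ x U [ j ]))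
                     (prefixSumsNonneg-∷ʳ (x j) prefixSums nonneg)
    ; sum-nonneg = subst (0ℤ ≤_) (sym (Σx-∷ʳ U j)) nonneg
    }
    where open Admissible adm

  unused-exhausted : ∀ {U} → Admissible U → length U ≡ t → unused U ≡ []
  unused-exhausted {U} adm len with unused U | ↭-length (Admissible.covers adm)
  ... | []    | _       = ≡.refl
  ... | j ∷ R | length≡ = contradiction (begin
    length U ℕ.+ length (j ∷ R)  ≡⟨ length-++ U ⟨
    length (U ++ j ∷ R)         ≡⟨ length≡ ⟩
    length (allFin t)           ≡⟨ length-tabulate (λ i → i) ⟩
    t                           ≡⟨ len ⟨
    length U                    ∎) (ℕ.m+1+n≢m (length U))
    where open ≡.≡-Reasoning

  module _ (x≢0 : ∀ i → x i ≢ 0ℤ) (Σx-allFin : Σx (allFin t) ≡ 0ℤ) where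

    Σx-used+unused : ∀ {U} → Admissible U → Σx U + Σx (unused U) ≡ 0ℤ
    Σx-used+unused {U} adm = begin
      Σx U + Σx (unused U)  ≡⟨ sumℤ-++ (map x U) _ ⟨
      sumℤ (map x U ++ map x (unused U))  ≡⟨ cong sumℤ (map-++ x U (unused U)) ⟨
      Σx (U ++ unused U)    ≡⟨ sumℤ-↭ (map⁺ x (Admissible.covers adm)) ⟩
      Σx (allFin t)         ≡⟨ Σx-allFin ⟩
      0ℤ                    ∎
      where open ≡.≡-Reasoning

    admissible⇒genCatalan : ∀ {U} → Admissible U → unused U ≡ [] → IsGenCatalan (map x U)
    admissible⇒genCatalan {U} adm exhausted =
      All.map⁺ (All.universal x≢0 U) , Σx≡0 , Admissible.prefixSums adm
      where
      Σx≡0 : Σx U ≡ 0ℤ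
      Σx≡0 = begin
        Σx U                  ≡⟨ ℤ.+-identityʳ (Σx U) ⟨
        Σx U + Σx []          ≡⟨ cong (λ R → Σx U + Σx R) exhausted ⟨
        Σx U + Σx (unused U)  ≡⟨ Σx-used+unused adm ⟩
        0ℤ                    ∎
        where open ≡.≡-Reasoning

    no-unused-sign : ∀ {U} → firstUnusedNeg x U ≡ nothing → firstUnusedPos x U ≡ nothing → unused U ≡ []
    no-unused-sign {U} noNeg noPos = no-member⇒[] (unused U) λ {i} i∈ →
      x≢0 i (ℤ.≤-antisym
        (ℤ.≮⇒≥ (head-filter-nothing (λ i → 0ℤ <? x i) (unused U) noPos i∈))
        (ℤ.≮⇒≥ (head-filter-nothing (λ i → x i <? 0ℤ) (unused U) noNeg i∈)))

    positive-choice : ∀ {U j} → Admissible U → firstUnusedPos x U ≡ just j →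
      j ∈ unused U × 0ℤ ≤ Σx U + x j
    positive-choice {U} adm pos with head-filter-just (λ i → 0ℤ <? x i) (unused U) pos
    ... | j∈ , 0<xj = j∈ , ℤ.+-mono-≤ (Admissible.sum-nonneg adm) (ℤ.<⇒≤ 0<xj)

    nonpositive-rest-choice : ∀ {U s} → Admissible U → firstUnusedPos x U ≡ nothing → s ∈ unused U →
      0ℤ ≤ Σx U + x s
    nonpositive-rest-choice {U} {s} adm noPos s∈ = begin
      0ℤ                    ≡⟨ Σx-used+unused adm ⟨
      Σx U + Σx (unused U)  ≤⟨ ℤ.+-monoʳ-≤ (Σx U) (sumℤ-nonpos≤∈ rest≤0 (∈-map⁺ x s∈)) ⟩
      Σx U + x s            ∎
      where
      open ℤ.≤-Reasoning
      rest≤0 : All (_≤ 0ℤ) (map x (unused U))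
      rest≤0 = All.map⁺ (All.tabulate λ i∈ →
        ℤ.≮⇒≥ (head-filter-nothing (λ i → 0ℤ <? x i) (unused U) noPos i∈))

    ValidChoice : List (Fin t) → Maybe (Fin t) → Set
    ValidChoice U (just j) = j ∈ unused U × 0ℤ ≤ Σx U + x j
    ValidChoice U nothing  = unused U ≡ []

    nextIndex-valid : ∀ {U S} → Admissible U → S ≡ Σx U → ValidChoice U (nextIndex x U S)
    nextIndex-valid {U} adm ≡.refl with firstUnusedNeg x U in neg | firstUnusedPos x U in pos
    ... | just s | _ with 0ℤ ≤? (Σx U + x s)
    ...   | yes nonneg = proj₁ (head-filter-just (λ i → x i <? 0ℤ) (unused U) neg) , nonneg
    nextIndex-valid adm ≡.refl | just s  | just j  | no _ = positive-choice adm pos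
    nextIndex-valid {U} adm ≡.refl | just s | nothing | no _ =
      s∈ , nonpositive-rest-choice adm pos s∈
      where s∈ = proj₁ (head-filter-just (λ i → x i <? 0ℤ) (unused U) neg)
    nextIndex-valid adm ≡.refl | nothing | just j  = positive-choice adm pos
    nextIndex-valid adm ≡.refl | nothing | nothing = no-unused-sign neg pos

    runSteps-genCatalan : ∀ k {U S} → Admissible U → S ≡ Σx U → length U ℕ.+ k ≡ t →
      IsGenCatalan (map x (runSteps x k U S))
    runSteps-genCatalan ℕ.zero adm _ len =
      admissible⇒genCatalan adm (unused-exhausted adm (≡.trans (sym (ℕ.+-identityʳ _)) len))
    runSteps-genCatalan (ℕ.suc k) {U} {S} adm S≡ len with nextIndex x U S | nextIndex-valid adm S≡
    ... | nothing | exhausted    = admissible⇒genCatalan adm exhausted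
    ... | just j  | j∈ , nonneg =
      runSteps-genCatalan k (admissible-∷ʳ adm j∈ nonneg)
        (≡.trans (cong (_+ x j) S≡) (sym (Σx-∷ʳ U j)))
        (≡.trans (cong (ℕ._+ k) (length-++ U)) (≡.trans (ℕ.+-assoc (length U) 1 k) len))

open Construction

lemma2p2 : (t : ℕ) (x : Fin t → ℤ) → (∀ i → x i ≢ 0ℤ) → IsGenCatalan (toList x)
    → IsGenCatalan (map x (assocPerm x))
lemma2p2 ℕ.zero x x≢0 (_ , Σx≡0 , _) = admissible⇒genCatalan x x≢0 Σx≡0 (admissible-[] x) ≡.refl
lemma2p2 (ℕ.suc t) x x≢0 (_ , Σx≡0 , prefixes) =
  runSteps-genCatalan x x≢0 Σx≡0 t first (sym (ℤ.+-identityʳ (x fzero))) ≡.refl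
  where
  0≤x0 : 0ℤ ≤ Σx x [] + x fzero
  0≤x0 = subst (0ℤ ≤_) (≡.trans (ℤ.+-identityʳ (x fzero)) (sym (ℤ.+-identityˡ (x fzero))))
           (prefixes 1 ℕ.≤-refl (ℕ.s≤s ℕ.z≤n))
  first : Admissible x [ fzero ]
  first = admissible-∷ʳ x (admissible-[] x) (∈-unused x {U = []} (λ ())) 0≤x0
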